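{- Let $(F_n)_{n\ge 0}$ be the Fibonacci sequence, $F_0=0$, $F_1=F_2=1$, $F_{n}=F_{n-1}+F_{n-2}$. For positive integers $n,m$ define $G(1,n,m)=F_n^m$ and $G(k+1,n,m)=F_{n\,G(k,n,m)}$ for all $k\ge 1$. Let $m,n\ge 1$, $k\ge 2$ be integers and $r=G(k,n,m)$. Then: (i) $2\mid r$ if and only if $3\mid n$ or $4\mid n$; (ii) if $2\nmid n$ and $3\nmid n$, then $r\equiv 1\pmod 4$; (iii) if $3\mid n$, then $r\equiv 0\pmod 8$.
   Context: $F_n$ denotes the $n$th Fibonacci number. -}

module Defs where

open import Data.Nat using (ℕ; zero; suc; _+_; _*_; _^_)

F : ℕ → ℕ
F zero = zero
F (suc zero) = suc zero
F (suc (suc n)) = F (suc n) + F n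

-- G k n m for k ≥ 1:  G 1 n m = F n ^ m,  G (k+1) n m = F (n * G k n m).
-- The value at k = 0 is a junk value (0) and is never used (the theorem needs k ≥ 2).
G : ℕ → ℕ → ℕ → ℕ
G zero n m = zero
G (suc zero) n m = F n ^ m
G (suc (suc k)) n m = F (n * G (suc k) n m)

module Submission where

-- Every divisibility property of G k n m used here reduces to
-- four facts about Fibonacci numbers, all of which only depend on j modulo 24:
--   3 ∣ j ⇔ 2 ∣ F j,   4 ∣ j ⇔ 3 ∣ F j,   6 ∣ j → 8 ∣ F j,
--   and F j ≡ 1 (mod 4) when gcd (j , 6) = 1.
-- (1) The addition formula F (j + p + 1) = F (p + 1) F (j + 1) + F p F j shows
--     that F is periodic modulo d with period p + 1 as soon as
--     F (p + 1) ≡ 0 and F p ≡ 1 (mod d); for d = 24 this holds with p = 23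
--     (the Pisano period of 24), so F j mod 24 depends only on j mod 24.
-- (2) Hence any decidable relation between j mod 24 and F j mod 24 can be
--     verified by evaluating it at the 24 residues; the four facts follow,
--     since divisibility by a divisor of 24 is preserved by reduction mod 24.
-- (3) By induction on the level, G (i + 1) n m is even when 3 ∣ n, divisible
--     by 3 when 4 ∣ n, and prime to 6 when 3 ∤ n and 4 ∤ n.
-- (4) For k = i + 2 we have G k n m = F (n · G (i + 1) n m), and the three
--     claims follow from (2) applied to j = n · G (i + 1) n m.

open import Defs
open import Data.Empty using (⊥-elim)
open import Data.Fin using (Fin; toℕ; fromℕ<)
open import Data.Fin.Properties using (all?; toℕ-fromℕ<)
open import Data.Nat
open import Data.Nat.DivMod
open import Data.Nat.Divisibility
open import Data.Nat.Primality using (Prime; prime?; euclidsLemma)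
open import Data.Nat.Properties using (+-identityʳ)
open import Data.Nat.Tactic.RingSolver using (solve-∀)
open import Data.Product using (_×_; _,_; proj₁; proj₂)
open import Data.Sum using (_⊎_; inj₁; inj₂)
open import Function.Base using (_∘_)
open import Function.Bundles using (_⇔_; mk⇔; Equivalence)
open import Relation.Binary.PropositionalEquality
open import Relation.Nullary using (yes; no; Dec; ¬?)
open import Relation.Nullary.Decidable using (True; toWitness; from-yes; _→-dec_)

open Equivalence using (to; from)
open ≡-Reasoning

F-add : ∀ p j → F (j + suc p) ≡ F (suc p) * F (suc j) + F p * F j
F-add p zero = base₀ (F (suc p)) (F p)
  where
  base₀ : ∀ x y → x ≡ x * 1 + y * 0
  base₀ = solve-∀
F-add p (suc zero) = base₁ (F (suc p)) (F p)
  where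
  base₁ : ∀ x y → x + y ≡ x * 1 + y * 1
  base₁ = solve-∀
F-add p (suc (suc j)) = begin
  F (suc j + suc p) + F (j + suc p)
    ≡⟨ cong₂ _+_ (F-add p (suc j)) (F-add p j) ⟩
  (A * F (suc (suc j)) + B * F (suc j)) + (A * F (suc j) + B * F j)
    ≡⟨ regroup A B (F (suc j)) (F j) ⟩
  A * F (suc (suc (suc j))) + B * F (suc (suc j)) ∎
  where
  A B : ℕ
  A = F (suc p)
  B = F p
  regroup : ∀ a b x y → (a * (x + y) + b * x) + (a * x + b * y) ≡ a * ((x + y) + x) + b * (x + y)
  regroup = solve-∀

-- If F (p + 1) ≡ 0 and F p ≡ 1 modulo d, then F is periodic modulo d with
-- period p + 1: the addition formula makes F (j + p + 1) ≡ F j (mod d).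
module Periodicity (d p a b : ℕ) .{{_ : NonZero d}}
                   (F[1+p]≡ad : F (suc p) ≡ a * d) (F[p]≡1+bd : F p ≡ 1 + b * d) where

  F-shift : ∀ j → F (j + suc p) % d ≡ F j % d
  F-shift j = begin
    F (j + suc p) % d                              ≡⟨ cong (_% d) (F-add p j) ⟩
    (F (suc p) * F (suc j) + F p * F j) % d        ≡⟨ cong (_% d) (cong₂ (λ u v → u * F (suc j) + v * F j) F[1+p]≡ad F[p]≡1+bd) ⟩
    (a * d * F (suc j) + (1 + b * d) * F j) % d    ≡⟨ cong (_% d) (regroup a b d (F (suc j)) (F j)) ⟩
    (F j + (a * F (suc j) + b * F j) * d) % d      ≡⟨ [m+kn]%n≡m%n (F j) (a * F (suc j) + b * F j) d ⟩
    F j % d ∎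
    where
    regroup : ∀ a b d x y → a * d * x + (1 + b * d) * y ≡ y + (a * x + b * y) * d
    regroup = solve-∀

  F-shift-many : ∀ q j → F (j + q * suc p) % d ≡ F j % d
  F-shift-many zero j = cong (λ i → F i % d) (+-identityʳ j)
  F-shift-many (suc q) j = begin
    F (j + (suc p + q * suc p)) % d  ≡⟨ cong (λ i → F i % d) (reassoc j (suc p) (q * suc p)) ⟩
    F (j + q * suc p + suc p) % d    ≡⟨ F-shift (j + q * suc p) ⟩
    F (j + q * suc p) % d            ≡⟨ F-shift-many q j ⟩
    F j % d ∎
    where
    reassoc : ∀ x y z → x + (y + z) ≡ x + z + y
    reassoc = solve-∀

  F-mod-period : ∀ j → F j % d ≡ F (j % suc p) % d
  F-mod-period j = begin
    F j % d                                       ≡⟨ cong (λ i → F i % d) (m≡m%n+[m/n]*n j (suc p)) ⟩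
    F (j % suc p + j / suc p * suc p) % d         ≡⟨ F-shift-many (j / suc p) (j % suc p) ⟩
    F (j % suc p) % d ∎

-- 24 is a Pisano period of itself: F 24 = 1932 · 24 and F 23 = 1 + 1194 · 24.
open Periodicity 24 23 1932 1194 refl refl using (F-mod-period)

by-residues : (S : ℕ → ℕ → Set) (S? : ∀ r v → Dec (S r v)) →
              {checked : True (all? (λ (r : Fin 24) → S? (toℕ r) (F (toℕ r) % 24)))} →
              ∀ j → S (j % 24) (F j % 24)
by-residues S S? {checked} j =
  subst (S (j % 24)) (sym (F-mod-period j))
    (subst (λ r → S r (F r % 24)) (toℕ-fromℕ< (m%n<n j 24))
      (toWitness checked (fromℕ< (m%n<n j 24))))

-- Divisibility by a divisor of 24 is unchanged by reduction modulo 24, so an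
-- implication between such divisibilities of x and y may be checked on residues.
transfer : ∀ {a b} x y → a ∣ 24 → b ∣ 24 → (a ∣ x % 24 → b ∣ y % 24) → a ∣ x → b ∣ y
transfer x y a∣24 b∣24 residue-law a∣x = ∣n∣m%n⇒∣m b∣24 (residue-law (%-presˡ-∣ a∣x a∣24))

F-even⇔ : ∀ j → 3 ∣ j ⇔ 2 ∣ F j
F-even⇔ j = mk⇔
  (transfer j (F j) (divides 8 refl) (divides 12 refl)
    (by-residues (λ r v → 3 ∣ r → 2 ∣ v) (λ r v → 3 ∣? r →-dec 2 ∣? v) j))
  (transfer (F j) j (divides 12 refl) (divides 8 refl)
    (by-residues (λ r v → 2 ∣ v → 3 ∣ r) (λ r v → 2 ∣? v →-dec 3 ∣? r) j))

F-three⇔ : ∀ j → 4 ∣ j ⇔ 3 ∣ F j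
F-three⇔ j = mk⇔
  (transfer j (F j) (divides 6 refl) (divides 8 refl)
    (by-residues (λ r v → 4 ∣ r → 3 ∣ v) (λ r v → 4 ∣? r →-dec 3 ∣? v) j))
  (transfer (F j) j (divides 8 refl) (divides 6 refl)
    (by-residues (λ r v → 3 ∣ v → 4 ∣ r) (λ r v → 3 ∣? v →-dec 4 ∣? r) j))

F-eight : ∀ j → 6 ∣ j → 8 ∣ F j
F-eight j = transfer j (F j) (divides 4 refl) (divides 3 refl)
  (by-residues (λ r v → 6 ∣ r → 8 ∣ v) (λ r v → 6 ∣? r →-dec 8 ∣? v) j)

F-one-mod-four : ∀ j → 2 ∤ j → 3 ∤ j → F j % 4 ≡ 1
F-one-mod-four j 2∤j 3∤j = begin
  F j % 4       ≡⟨ m∣n⇒o%n%m≡o%m 4 24 (F j) (divides 6 refl) ⟨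
  F j % 24 % 4  ≡⟨ residue-law (2∤j ∘ ∣n∣m%n⇒∣m (divides 12 refl))
                               (3∤j ∘ ∣n∣m%n⇒∣m (divides 8 refl)) ⟩
  1 ∎
  where
  residue-law : 2 ∤ j % 24 → 3 ∤ j % 24 → F j % 24 % 4 ≡ 1
  residue-law = by-residues (λ r v → 2 ∤ r → 3 ∤ r → v % 4 ≡ 1)
    (λ r v → ¬? (2 ∣? r) →-dec (¬? (3 ∣? r) →-dec v % 4 ≟ 1)) j

prime-2 : Prime 2
prime-2 = from-yes (prime? 2)

prime-3 : Prime 3
prime-3 = from-yes (prime? 3)

prime∤* : ∀ {p x y} → Prime p → p ∤ x → p ∤ y → p ∤ x * y
prime∤* pp p∤x p∤y p∣xy with euclidsLemma _ _ pp p∣xy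
... | inj₁ p∣x = p∤x p∣x
... | inj₂ p∣y = p∤y p∣y

prime∤^ : ∀ {p x} m → Prime p → p ∤ x → p ∤ x ^ m
prime∤^ zero    pp p∤x p∣1 = p∤x (∣-trans p∣1 (1∣ _))
prime∤^ (suc m) pp p∤x     = prime∤* pp p∤x (prime∤^ m pp p∤x)

-- An odd factor does not help divisibility by 4: if 4 ∣ n s with s odd,
-- then 2 ∣ n, say n = c · 2, and cancelling 2 gives 2 ∣ c s, hence 2 ∣ c.
4∣*odd⇒4∣ : ∀ {n s} → 2 ∤ s → 4 ∣ n * s → 4 ∣ n
4∣*odd⇒4∣ {n} {s} 2∤s 4∣ns with euclidsLemma n s prime-2 (∣-trans (divides 2 refl) 4∣ns)
... | inj₂ 2∣s = ⊥-elim (2∤s 2∣s)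
... | inj₁ (divides c refl) = *-monoˡ-∣ 2 (odd-cancel 2∣cs)
  where
  2∣cs : 2 ∣ c * s
  2∣cs = *-cancelˡ-∣ 2 (subst (4 ∣_) (regroup c s) 4∣ns)
    where
    regroup : ∀ c s → c * 2 * s ≡ 2 * (c * s)
    regroup = solve-∀
  odd-cancel : 2 ∣ c * s → 2 ∣ c
  odd-cancel 2∣cs with euclidsLemma c s prime-2 2∣cs
  ... | inj₁ 2∣c = 2∣c
  ... | inj₂ 2∣s = ⊥-elim (2∤s 2∣s)

G-even : ∀ i {n m} → 1 ≤ m → 3 ∣ n → 2 ∣ G (suc i) n m
G-even zero    {n} {suc m} _ 3∣n = ∣m⇒∣m*n (F n ^ m) (to (F-even⇔ n) 3∣n)
G-even (suc i) {n} {m}     _ 3∣n = to (F-even⇔ _) (∣m⇒∣m*n (G (suc i) n m) 3∣n)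

G-three : ∀ i {n m} → 1 ≤ m → 4 ∣ n → 3 ∣ G (suc i) n m
G-three zero    {n} {suc m} _ 4∣n = ∣m⇒∣m*n (F n ^ m) (to (F-three⇔ n) 4∣n)
G-three (suc i) {n} {m}     _ 4∣n = to (F-three⇔ _) (∣m⇒∣m*n (G (suc i) n m) 4∣n)

G-prime-to-6 : ∀ i {n m} → 3 ∤ n → 4 ∤ n → 2 ∤ G (suc i) n m × 3 ∤ G (suc i) n m
G-prime-to-6 zero {n} {m} 3∤n 4∤n =
  prime∤^ m prime-2 (3∤n ∘ from (F-even⇔ n)) , prime∤^ m prime-3 (4∤n ∘ from (F-three⇔ n))
G-prime-to-6 (suc i) {n} {m} 3∤n 4∤n =
  (prime∤* prime-3 3∤n (proj₂ previous) ∘ from (F-even⇔ _)) ,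
  (4∤n ∘ 4∣*odd⇒4∣ (proj₁ previous) ∘ from (F-three⇔ _))
  where
  previous : 2 ∤ G (suc i) n m × 3 ∤ G (suc i) n m
  previous = G-prime-to-6 i 3∤n 4∤n

lemma2p4 : (m n k : ℕ) → m ≥ 1 → n ≥ 1 → k ≥ 2 →
    ((2 ∣ G k n m) ⇔ (3 ∣ n ⊎ 4 ∣ n))
    × (2 ∤ n → 3 ∤ n → G k n m % 4 ≡ 1)
    × (3 ∣ n → G k n m % 8 ≡ 0)
lemma2p4 m n (suc zero) _ _ (s≤s ())
lemma2p4 m n (suc (suc i)) m≥1 _ _ = mk⇔ even⇒ ⇒even , one-mod-four , eight
  where
  s : ℕ
  s = G (suc i) n m
  even⇒ : 2 ∣ F (n * s) → 3 ∣ n ⊎ 4 ∣ n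
  even⇒ 2∣F with 3 ∣? n | 4 ∣? n
  ... | yes 3∣n | _       = inj₁ 3∣n
  ... | no _    | yes 4∣n = inj₂ 4∣n
  ... | no 3∤n  | no 4∤n  =
    ⊥-elim (prime∤* prime-3 3∤n (proj₂ (G-prime-to-6 i 3∤n 4∤n)) (from (F-even⇔ _) 2∣F))
  ⇒even : 3 ∣ n ⊎ 4 ∣ n → 2 ∣ F (n * s)
  ⇒even (inj₁ 3∣n) = to (F-even⇔ _) (∣m⇒∣m*n s 3∣n)
  ⇒even (inj₂ 4∣n) = to (F-even⇔ _) (∣n⇒∣m*n n (G-three i m≥1 4∣n))
  one-mod-four : 2 ∤ n → 3 ∤ n → F (n * s) % 4 ≡ 1
  one-mod-four 2∤n 3∤n =
    F-one-mod-four _ (prime∤* prime-2 2∤n (proj₁ s-prime-to-6)) (prime∤* prime-3 3∤n (proj₂ s-prime-to-6))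
    where
    s-prime-to-6 : 2 ∤ s × 3 ∤ s
    s-prime-to-6 = G-prime-to-6 i 3∤n (2∤n ∘ ∣-trans (divides 2 refl))
  eight : 3 ∣ n → F (n * s) % 8 ≡ 0
  eight 3∣n = n∣m⇒m%n≡0 _ 8 (F-eight _ (*-pres-∣ 3∣n (G-even i m≥1 3∣n)))
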